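{- The nested sequent calculi $\mathsf{ND}$ (for modal logic $\mathsf{D}$) and $\mathsf{NT}$ (for modal logic $\mathsf{T}$) have the bisimulation nested-sequent uniform interpolation property (BNUIP).
   Context: Modal formulas are in negation normal form built from $\bot,\top,p,\overline p$ with $\land,\lor,\Box,\Diamond$. A nested sequent has the form $\varphi_1,\dots,\varphi_n,[\Gamma_1],\dots,[\Gamma_m]$; its nodes are labelled by finite sequences of naturals (root $1$, the $i$-th box inside node $\sigma$ is $\sigma*i$), $\mathcal{L}(\Gamma)$ is the set of labels and $\sigma:\varphi\in\Gamma$ means $\varphi$ occurs at node $\sigma$. $\mathsf{NK}$ is Brünnler's terminating nested calculus for $\mathsf{K}$ (rules $\mathsf{id_P},\mathsf{id_\top},\lor,\land,\Box,\mathsf{k}$); $\mathsf{ND}$ adds rule $\mathsf{d}$ (from $\Gamma\{\Diamond\varphi,[\varphi]\}$ infer $\Gamma\{\Diamond\varphi\}$) and $\mathsf{NT}$ adds rule $\mathsf{t}$ (from $\Gamma\{\Diamond\varphi,\varphi\}$ infer $\Gamma\{\Diamond\varphi\}$); they are sound and complete for $\mathsf{D}=\mathsf{K}+\Box\varphi\to\Diamond\varphi$ and $\mathsf{T}=\mathsf{K}+\Box\varphi\to\varphi$. $\mathsf{D}$-models are finite intransitive directed trees with serial accessibility (so leaves are reflexive, other nodes irreflexive); $\mathsf{T}$-models are finite intransitive trees with reflexive accessibility. A multiworld interpretation of $\Gamma$ into $\mathcal{M}=(W,R,V)$ is $\mathcal{I}:\mathcal{L}(\Gamma)\to W$ with $\mathcal{I}(\sigma)R\,\mathcal{I}(\sigma*n)$;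 $\mathcal{M},\mathcal{I}\models\Gamma$ iff $\mathcal{M},\mathcal{I}(\sigma)\models\varphi$ for some $\sigma:\varphi\in\Gamma$. Multiformulas: $\mho ::= \sigma:\varphi\mid(\mho\curlywedge\mho)\mid(\mho\curlyvee\mho)$, with $\curlywedge$ (multiformula conjunction) and $\curlyvee$ (multiformula disjunction) interpreted classically and $\mathcal{M},\mathcal{I}\models\sigma:\varphi$ iff $\mathcal{M},\mathcal{I}(\sigma)\models\varphi$. $(\mathcal{M},\mathcal{I})\sim_p(\mathcal{M}',\mathcal{I}')$ means there is a bisimulation up to $p$ (agreement on all atoms other than $p$, plus forth and back) relating $\mathcal{I}(\sigma)$ and $\mathcal{I}'(\sigma)$ for all labels $\sigma$. A nested calculus $\mathsf{NL}$ for logic $\mathsf{L}$ has the BNUIP if for each nested sequent $\Gamma$ and atom $p$ there is a multiformula $A_p(\Gamma)$ such that: (i) $\mathit{Var}(A_p(\Gamma))\subseteq\mathit{Var}(\Gamma)\setminus\{p\}$ and $\mathcal{L}(A_p(\Gamma))\subseteq\mathcal{L}(\Gamma)$; (ii) for every multiworld interpretation $\mathcal{I}$ of $\Gamma$ into an $\mathsf{L}$-model $\mathcal{M}$, $\mathcal{M},\mathcal{I}\models A_p(\Gamma)$ implies $\mathcal{M},\mathcal{I}\models\Gamma$; (iii)$'$ if $\mathcal{M},\mathcal{I}\not\models A_p(\Gamma)$ for an $\mathsf{L}$-model $\mathcal{M}$, then there are an $\mathsf{L}$-model $\mathcal{M}'$ and a multiworld interpretation $\mathcal{I}'$ of $\Gamma$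 into $\mathcal{M}'$ with $(\mathcal{M}',\mathcal{I}')\sim_p(\mathcal{M},\mathcal{I})$ and $\mathcal{M}',\mathcal{I}'\not\models\Gamma$. -}

module Defs where

open import Data.Nat using (ℕ; suc)
open import Data.Bool using (Bool; true; false)
open import Data.Fin using (Fin; toℕ)
open import Data.List using (List; []; _∷_; _++_; length; lookup)
open import Data.List.Relation.Unary.Any using (Any)
open import Data.List.Membership.Propositional using (_∈_)
open import Data.Product using (Σ; _×_; _,_; ∃)
open import Data.Sum using (_⊎_)
open import Data.Empty using (⊥)
open import Data.Unit using (⊤)
open import Relation.Binary.PropositionalEquality using (_≡_; _≢_)
open import Relation.Nullary using (¬_)

data Fm : Set where
  ⊥' ⊤'   : Fm
  var nvar : ℕ → Fm
  _∧'_ _∨'_ : Fm → Fm → Fm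
  □ ◇     : Fm → Fm

data OccF (q : ℕ) : Fm → Set where
  ovar  : OccF q (var q)
  onvar : OccF q (nvar q)
  ∧l : ∀ {a b} → OccF q a → OccF q (a ∧' b)
  ∧r : ∀ {a b} → OccF q b → OccF q (a ∧' b)
  ∨l : ∀ {a b} → OccF q a → OccF q (a ∨' b)
  ∨r : ∀ {a b} → OccF q b → OccF q (a ∨' b)
  o□ : ∀ {a} → OccF q a → OccF q (□ a)
  o◇ : ∀ {a} → OccF q a → OccF q (◇ a)

-- Nested sequents  φ₁,…,φₙ,[Γ₁],…,[Γₘ]

data Seq : Set where
  seq : List Fm → List Seq → Seq

fmls : Seq → List Fm
fmls (seq Φ _) = Φ

-- Sub Γ π Δ : following the (1-based) box indices π from the root of Γ
-- leads to the nested sequent Δ.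
data Sub : Seq → List ℕ → Seq → Set where
  here  : ∀ {Γ} → Sub Γ [] Γ
  there : ∀ {Φ Γs} (k : Fin (length Γs)) {π Δ} →
          Sub (lookup Γs k) π Δ → Sub (seq Φ Γs) (suc (toℕ k) ∷ π) Δ

-- Labels: finite sequences of naturals, root = 1, σ*i = σ ++ [ i ]
Label : Set
Label = List ℕ

_⋆_ : Label → ℕ → Label
σ ⋆ i = σ ++ (i ∷ [])

IsLabel : Seq → Label → Set
IsLabel Γ σ = Σ (List ℕ) λ π → σ ≡ 1 ∷ π × Σ Seq λ Δ → Sub Γ π Δ

_∶_∈S_ : Label → Fm → Seq → Set
σ ∶ φ ∈S Γ = Σ (List ℕ) λ π → σ ≡ 1 ∷ π × Σ Seq λ Δ → Sub Γ π Δ × φ ∈ fmls Δ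

OccS : ℕ → Seq → Set
OccS q Γ = Σ (List ℕ) λ π → Σ Seq λ Δ → Sub Γ π Δ × Any (OccF q) (fmls Δ)

record Model : Set₁ where
  field
    W : Set
    R : W → W → Set
    V : W → ℕ → Bool
open Model public

_,_⊩_ : (M : Model) → W M → Fm → Set
M , w ⊩ ⊥' = ⊥
M , w ⊩ ⊤' = ⊤
M , w ⊩ var p = V M w p ≡ true
M , w ⊩ nvar p = V M w p ≡ false
M , w ⊩ (a ∧' b) = (M , w ⊩ a) × (M , w ⊩ b)
M , w ⊩ (a ∨' b) = (M , w ⊩ a) ⊎ (M , w ⊩ b)
M , w ⊩ □ a = ∀ v → R M w v → M , v ⊩ a
M , w ⊩ ◇ a = Σ (W M) λ v → R M w v × (M , v ⊩ a)

data Tree : Set where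
  node : (ℕ → Bool) → List Tree → Tree

children : Tree → List Tree
children (node _ ts) = ts

val : Tree → ℕ → Bool
val (node v _) = v

data Pos : Tree → Set where
  here : ∀ {t} → Pos t
  down : ∀ {v ts} (k : Fin (length ts)) → Pos (lookup ts k) → Pos (node v ts)

subtree : ∀ {t} → Pos t → Tree
subtree {t} here = t
subtree (down k x) = subtree x

data Child : {t : Tree} → Pos t → Pos t → Set where
  top  : ∀ {v ts} (k : Fin (length ts)) → Child {node v ts} here (down k here)
  deep : ∀ {v ts} (k : Fin (length ts)) {x y : Pos (lookup ts k)} →
         Child x y → Child {node v ts} (down k x) (down k y)

-- D-model: tree edges, plus reflexive loops exactly at leaves (serial)
DModel : Tree → Model
DModel t = record
  { W = Pos t
  ; R = λ x y → Child x y ⊎ (children (subtree x) ≡ [] × x ≡ y)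
  ; V = λ x → val (subtree x) }

TModel : Tree → Model
TModel t = record
  { W = Pos t
  ; R = λ x y → Child x y ⊎ x ≡ y
  ; V = λ x → val (subtree x) }

record Interp (Γ : Seq) (M : Model) : Set where
  field
    I    : Label → W M
    edge : ∀ σ n → IsLabel Γ σ → IsLabel Γ (σ ⋆ n) → R M (I σ) (I (σ ⋆ n))
open Interp public

_⊨S_ : ∀ {Γ M} → Interp Γ M → Seq → Set
_⊨S_ {Γ} {M} 𝓘 _ = Σ Label λ σ → Σ Fm λ φ → σ ∶ φ ∈S Γ × (M , I 𝓘 σ ⊩ φ)

data MF : Set where
  _∶_ : Label → Fm → MF
  _⋏_ _⋎_ : MF → MF → MF

_,_⊨MF_ : (M : Model) → (Label → W M) → MF → Set
M , I ⊨MF (σ ∶ φ) = M , I σ ⊩ φ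
M , I ⊨MF (A ⋏ B) = (M , I ⊨MF A) × (M , I ⊨MF B)
M , I ⊨MF (A ⋎ B) = (M , I ⊨MF A) ⊎ (M , I ⊨MF B)

AllLabels : (Label → Set) → MF → Set
AllLabels P (σ ∶ φ) = P σ
AllLabels P (A ⋏ B) = AllLabels P A × AllLabels P B
AllLabels P (A ⋎ B) = AllLabels P A × AllLabels P B

OccMF : ℕ → MF → Set
OccMF q (σ ∶ φ) = OccF q φ
OccMF q (A ⋏ B) = OccMF q A ⊎ OccMF q B
OccMF q (A ⋎ B) = OccMF q A ⊎ OccMF q B

record BisimUpTo (p : ℕ) (M M' : Model) : Set₁ where
  field
    Z     : W M → W M' → Set
    atoms : ∀ {w w'} → Z w w' → ∀ q → q ≢ p → V M w q ≡ V M' w' q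
    forth : ∀ {w w' v} → Z w w' → R M w v → Σ (W M') λ v' → R M' w' v' × Z v v'
    back  : ∀ {w w' v'} → Z w w' → R M' w' v' → Σ (W M) λ v → R M w v × Z v v'
open BisimUpTo public

Bisim∼ : (p : ℕ) (Γ : Seq) {M' M : Model} → Interp Γ M' → Interp Γ M → Set₁
Bisim∼ p Γ {M'} {M} 𝓘' 𝓘 = Σ (BisimUpTo p M' M) λ B →
  ∀ σ → IsLabel Γ σ → Z B (I 𝓘' σ) (I 𝓘 σ)

-- BNUIP for a logic L whose models are (up to isomorphism) the models
-- LModel t for finite trees t.

BNUIP : (Tree → Model) → Set₁
BNUIP LModel = ∀ (Γ : Seq) (p : ℕ) → Σ MF λ A →
  ((∀ q → OccMF q A → OccS q Γ × q ≢ p) × AllLabels (IsLabel Γ) A)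
  × (∀ t (𝓘 : Interp Γ (LModel t)) → LModel t , I 𝓘 ⊨MF A → 𝓘 ⊨S Γ)
  × (∀ t (𝓘 : Interp Γ (LModel t)) → ¬ (LModel t , I 𝓘 ⊨MF A) →
       Σ Tree λ t' → Σ (Interp Γ (LModel t')) λ 𝓘' →
         Bisim∼ p Γ 𝓘' 𝓘 × ¬ (𝓘' ⊨S Γ))

{-# OPTIONS --safe #-}

-- A_p(Γ) is read off a proof search for Γ. At each node the invertible rules (and
-- the t-rule in T) reduce the formulas to literals, diamonds ◇a and boxes □b. The
-- node contributes its p-free literals (⊤ if both p and p̄ occur), ◇ of the
-- interpolant of the diamond contents (for the successor that seriality provides)
-- and, for every box, □ of the interpolant of b together with the diamond contents;
-- the nested sequents contribute their interpolants with the diamond contents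
-- added, as in the k-rule. The inner interpolants are those of one-node sequents of
-- smaller modal depth, so the recursion is bounded by the modal depth of Γ.
-- Conversely, if a model falsifies A_p(Γ), a countermodel bisimilar up to p is
-- built bottom-up: below a copy of each interpreted world, with p reset so that the
-- refuted literals stay false, hang the countermodels of its nested sequents, a
-- refutation of the diamond contents at every successor of the world, and a
-- refuting successor for every box.

module Submission where

open import Defs
open import Data.Bool using (Bool; true; false)
import Data.Bool as Bool
open import Data.Empty using (⊥; ⊥-elim)
open import Data.Fin using (Fin; toℕ; zero; suc)
open import Data.Fin.Properties using (toℕ-injective)
open import Data.List using (List; []; _∷_; _++_; length; lookup; map; allFin; filter; drop; foldr)
open import Data.List.Properties using (∷-injectiveʳ)
open import Data.List.Membership.Propositional using (_∈_; find; lose)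
open import Data.List.Membership.Propositional.Properties
  using (∈-map⁺; ∈-map⁻; ∈-++⁺ˡ; ∈-++⁺ʳ; ∈-++⁻; ∈-allFin; ∈-filter⁺; ∈-filter⁻)
open import Data.List.Relation.Unary.All as All using (All; []; _∷_; all?)
import Data.List.Relation.Unary.All.Properties as All
open import Data.List.Relation.Unary.All.Properties using (¬All⇒Any¬)
open import Data.List.Relation.Unary.Any as Any using (Any; here; there; any?)
import Data.List.Relation.Unary.Any.Properties as Any
open import Data.Nat using (ℕ; zero; suc; _⊔_; _≟_; _<_; _≤_; s≤s)
open import Data.Nat.Properties
  using (suc-injective; ≤-trans; ≤-pred; n≤1+n; m≤m⊔n; m≤n⊔m; m⊔n<o⇒m<o; m⊔n<o⇒n<o)
open import Data.Product using (Σ; _×_; _,_; proj₁; proj₂)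
open import Data.Product.Properties using (≡-dec)
open import Data.Sum using (_⊎_; inj₁; inj₂)
import Data.Sum as Sum
open import Data.Unit using (⊤; tt)
open import Function using (_∘_)
open import Relation.Binary.PropositionalEquality using (_≡_; _≢_; refl; sym; trans; cong; subst)
open import Relation.Nullary using (¬_; Dec; yes; no; ¬?; does)
open import Data.List.Membership.DecPropositional (≡-dec Bool._≟_ _≟_) using (_∈?_)
open import Relation.Nullary.Decidable using (map′; _×-dec_; _⊎-dec_)

-- Tree models of D and T

data Logic : Set where
  D T : Logic

Accessible : Logic → (t : Tree) → Pos t → Pos t → Set
Accessible D t = R (DModel t)
Accessible T t = R (TModel t)

model : Logic → Tree → Model
model l t = record { W = Pos t ; R = Accessible l t ; V = λ x → val (subtree x) }

IsReflexive : Logic → Set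
IsReflexive D = ⊥
IsReflexive T = ⊤

RootLoops : Logic → List Tree → Set
RootLoops D ts = ts ≡ []
RootLoops T ts = ⊤

R-root⁻ : ∀ l {v ts w} → Accessible l (node v ts) here w →
          (Σ (Fin (length ts)) λ k → w ≡ down k here) ⊎ (w ≡ here × RootLoops l ts)
R-root⁻ D (inj₁ (top k)) = inj₁ (k , refl)
R-root⁻ D (inj₂ (leaf , refl)) = inj₂ (refl , leaf)
R-root⁻ T (inj₁ (top k)) = inj₁ (k , refl)
R-root⁻ T (inj₂ refl) = inj₂ (refl , tt)

R-root-child : ∀ l {v ts} (k : Fin (length ts)) → Accessible l (node v ts) here (down k here)
R-root-child D k = inj₁ (top k)
R-root-child T k = inj₁ (top k)

R-refl : ∀ l {t} (x : Pos t) → IsReflexive l → Accessible l t x x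
R-refl T x _ = inj₂ refl

◇-refl : ∀ l {t} (x : Pos t) {φ} → IsReflexive l → model l t , x ⊩ φ → model l t , x ⊩ ◇ φ
◇-refl l x refl-l h = x , R-refl l x refl-l , h

child-exists : ∀ {t} (x : Pos t) {c cs} → children (subtree x) ≡ c ∷ cs → Σ (Pos t) (Child x)
child-exists {node v (c ∷ cs)} here refl = down zero here , top zero
child-exists (down k x) leaf with child-exists x leaf
... | y , x→y = down k y , deep k x→y

R-serial : ∀ l {t} (x : Pos t) → Σ (Pos t) (Accessible l t x)
R-serial T x = x , inj₂ refl
R-serial D x with children (subtree x) in eq
... | [] = x , inj₂ (refl , refl)
... | c ∷ cs = let y , x→y = child-exists x eq in y , inj₁ x→y

loop-reflexive : ∀ l {t} (x : Pos t) ts → (∀ y → Accessible l t x y → Fin (length ts)) →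
                 RootLoops l ts → IsReflexive l
loop-reflexive D x .[] covers refl with covers _ (proj₂ (R-serial D x))
... | ()
loop-reflexive T x ts covers _ = tt

embed : ∀ {t} (y : Pos t) → Pos (subtree y) → Pos t
embed here q = q
embed (down k y) q = down k (embed y q)

subtree-embed : ∀ {t} (y : Pos t) q → subtree (embed y q) ≡ subtree q
subtree-embed here q = refl
subtree-embed (down k y) q = subtree-embed y q

embed-here : ∀ {t} (y : Pos t) → embed y here ≡ y
embed-here here = refl
embed-here (down k y) = cong (down k) (embed-here y)

Child-embed⁺ : ∀ {t} (y : Pos t) {q q'} → Child q q' → Child (embed y q) (embed y q')
Child-embed⁺ here c = c
Child-embed⁺ (down k y) c = deep k (Child-embed⁺ y c)

Child-embed⁻ : ∀ {t} (y : Pos t) {q w} → Child (embed y q) w →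
               Σ (Pos (subtree y)) λ q' → w ≡ embed y q' × Child q q'
Child-embed⁻ here c = _ , refl , c
Child-embed⁻ (down k y) (deep .k c) with Child-embed⁻ y c
... | q' , refl , c' = q' , refl , c'

R-embed⁺ : ∀ l {t} (y : Pos t) {q q'} → Accessible l (subtree y) q q' → Accessible l t (embed y q) (embed y q')
R-embed⁺ D y (inj₁ c) = inj₁ (Child-embed⁺ y c)
R-embed⁺ D y {q} (inj₂ (leaf , refl)) = inj₂ (trans (cong children (subtree-embed y q)) leaf , refl)
R-embed⁺ T y (inj₁ c) = inj₁ (Child-embed⁺ y c)
R-embed⁺ T y (inj₂ refl) = inj₂ refl

R-embed⁻ : ∀ l {t} (y : Pos t) {q w} → Accessible l t (embed y q) w →
           Σ (Pos (subtree y)) λ q' → w ≡ embed y q' × Accessible l (subtree y) q q'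
R-embed⁻ D y (inj₁ c) with Child-embed⁻ y c
... | q' , refl , c' = q' , refl , inj₁ c'
R-embed⁻ D y {q} (inj₂ (leaf , refl)) = q , refl , inj₂ (trans (cong children (sym (subtree-embed y q))) leaf , refl)
R-embed⁻ T y (inj₁ c) with Child-embed⁻ y c
... | q' , refl , c' = q' , refl , inj₁ c'
R-embed⁻ T y {q} (inj₂ refl) = q , refl , inj₂ refl

⊩-embed⁻ : ∀ l {t} (y : Pos t) (q : Pos (subtree y)) φ →
           model l t , embed y q ⊩ φ → model l (subtree y) , q ⊩ φ
⊩-embed⁻ l y q ⊤' h = h
⊩-embed⁻ l y q (var r) h = trans (cong (λ s → val s r) (sym (subtree-embed y q))) h
⊩-embed⁻ l y q (nvar r) h = trans (cong (λ s → val s r) (sym (subtree-embed y q))) h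
⊩-embed⁻ l y q (a ∧' b) (ha , hb) = ⊩-embed⁻ l y q a ha , ⊩-embed⁻ l y q b hb
⊩-embed⁻ l y q (a ∨' b) (inj₁ h) = inj₁ (⊩-embed⁻ l y q a h)
⊩-embed⁻ l y q (a ∨' b) (inj₂ h) = inj₂ (⊩-embed⁻ l y q b h)
⊩-embed⁻ l y q (□ a) h q' r = ⊩-embed⁻ l y q' a (h (embed y q') (R-embed⁺ l y r))
⊩-embed⁻ l y q (◇ a) (w , r , h) with R-embed⁻ l y r
... | q' , refl , r' = q' , r' , ⊩-embed⁻ l y q' a h

subtree-bisim : ∀ l p {t} (y : Pos t) → Σ (BisimUpTo p (model l (subtree y)) (model l t)) λ B → Z B here y
subtree-bisim l p y = record
  { Z = λ q w → w ≡ embed y q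
  ; atoms = λ { {q} refl r _ → cong (λ s → val s r) (sym (subtree-embed y q)) }
  ; forth = λ { refl r → _ , R-embed⁺ l y r , refl }
  ; back = λ { refl r → let q' , e , r' = R-embed⁻ l y r in q' , r' , e }
  } , sym (embed-here y)

childPositions : ∀ {t} → Pos t → List (Pos t)
childPositions {node v ts} here = map (λ k → down k here) (allFin (length ts))
childPositions {node v ts} (down k x) = map (down k) (childPositions x)

∈-childPositions⁺ : ∀ {t} {x y : Pos t} → Child x y → y ∈ childPositions x
∈-childPositions⁺ (top k) = ∈-map⁺ (λ k → down k here) (∈-allFin k)
∈-childPositions⁺ (deep k c) = ∈-map⁺ (down k) (∈-childPositions⁺ c)

∈-childPositions⁻ : ∀ {t} (x : Pos t) {y} → y ∈ childPositions x → Child x y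
∈-childPositions⁻ {node v ts} here m with ∈-map⁻ (λ k → down k here) m
... | k , _ , refl = top k
∈-childPositions⁻ {node v ts} (down k x) m with ∈-map⁻ (down k) m
... | y , m' , refl = deep k (∈-childPositions⁻ x m')

loopIfLeaf : ∀ {t} (x : Pos t) → List Tree → List (Pos t)
loopIfLeaf x [] = x ∷ []
loopIfLeaf x (_ ∷ _) = []

successors : (l : Logic) {t : Tree} → Pos t → List (Pos t)
successors D x = childPositions x ++ loopIfLeaf x (children (subtree x))
successors T x = x ∷ childPositions x

∈-successors⁺ : ∀ (l : Logic) {t} {x y : Pos t} → Accessible l t x y → y ∈ successors l x
∈-successors⁺ D (inj₁ c) = ∈-++⁺ˡ (∈-childPositions⁺ c)
∈-successors⁺ D {x = x} (inj₂ (leaf , refl)) = ∈-++⁺ʳ (childPositions x) (loop leaf)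
  where loop : ∀ {cs} → cs ≡ [] → x ∈ loopIfLeaf x cs
        loop refl = here refl
∈-successors⁺ T (inj₁ c) = there (∈-childPositions⁺ c)
∈-successors⁺ T (inj₂ refl) = here refl

∈-successors⁻ : ∀ (l : Logic) {t} (x : Pos t) {y} → y ∈ successors l x → Accessible l t x y
∈-successors⁻ D x m with ∈-++⁻ (childPositions x) m
... | inj₁ m' = inj₁ (∈-childPositions⁻ x m')
... | inj₂ m' = inj₂ (loop (children (subtree x)) refl m')
  where loop : ∀ cs {y} → cs ≡ children (subtree x) → y ∈ loopIfLeaf x cs → children (subtree x) ≡ [] × x ≡ y
        loop [] leaf (here refl) = sym leaf , refl
∈-successors⁻ T x (here refl) = inj₂ refl
∈-successors⁻ T x (there m) = inj₁ (∈-childPositions⁻ x m)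

module _ (l : Logic) {t : Tree} (x : Pos t) {P : Pos t → Set} (P? : ∀ y → Dec (P y)) where

  ◇-dec : Dec (Σ (Pos t) λ y → Accessible l t x y × P y)
  ◇-dec = map′ (λ a → let y , m , py = find a in y , ∈-successors⁻ l x m , py)
               (λ (y , r , py) → lose (∈-successors⁺ l r) py)
               (any? P? (successors l x))

  □-dec : Dec (∀ y → Accessible l t x y → P y)
  □-dec = map′ (λ a y r → All.lookup a (∈-successors⁺ l r))
               (λ f → All.tabulate (λ m → f _ (∈-successors⁻ l x m)))
               (all? P? (successors l x))

  ¬□⇒◇¬ : ¬ (∀ y → Accessible l t x y → P y) → Σ (Pos t) λ y → Accessible l t x y × ¬ P y
  ¬□⇒◇¬ ¬□ with find (¬All⇒Any¬ P? (successors l x) (λ a → ¬□ (λ y r → All.lookup a (∈-successors⁺ l r))))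
  ... | y , m , ¬py = y , ∈-successors⁻ l x m , ¬py

⊩-dec : ∀ l {t} (x : Pos t) φ → Dec (model l t , x ⊩ φ)
⊩-dec l x ⊥' = no λ ()
⊩-dec l x ⊤' = yes tt
⊩-dec l x (var q) = val (subtree x) q Bool.≟ true
⊩-dec l x (nvar q) = val (subtree x) q Bool.≟ false
⊩-dec l x (a ∧' b) = ⊩-dec l x a ×-dec ⊩-dec l x b
⊩-dec l x (a ∨' b) = ⊩-dec l x a ⊎-dec ⊩-dec l x b
⊩-dec l x (□ a) = □-dec l x (λ y → ⊩-dec l y a)
⊩-dec l x (◇ a) = ◇-dec l x (λ y → ⊩-dec l y a)

⊨MF-dec : ∀ (M : Model) (I : Label → W M) → (∀ w φ → Dec (M , w ⊩ φ)) → ∀ A → Dec (M , I ⊨MF A)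
⊨MF-dec M I ⊩? (σ ∶ φ) = ⊩? (I σ) φ
⊨MF-dec M I ⊩? (A ⋏ B) = ⊨MF-dec M I ⊩? A ×-dec ⊨MF-dec M I ⊩? B
⊨MF-dec M I ⊩? (A ⋎ B) = ⊨MF-dec M I ⊩? A ⊎-dec ⊨MF-dec M I ⊩? B

⋁ : List Fm → Fm
⋁ [] = ⊥'
⋁ (φ ∷ φs) = φ ∨' ⋁ φs

module _ {M : Model} {w : W M} where

  ⊩-⋁⁻ : ∀ φs → M , w ⊩ ⋁ φs → Any (λ φ → M , w ⊩ φ) φs
  ⊩-⋁⁻ (φ ∷ φs) (inj₁ h) = here h
  ⊩-⋁⁻ (φ ∷ φs) (inj₂ h) = there (⊩-⋁⁻ φs h)

  ⊩-⋁⁺ : ∀ {φs} → Any (λ φ → M , w ⊩ φ) φs → M , w ⊩ ⋁ φs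
  ⊩-⋁⁺ (here h) = inj₁ h
  ⊩-⋁⁺ (there h) = inj₂ (⊩-⋁⁺ h)

OccF-⋁⁻ : ∀ {q} φs → OccF q (⋁ φs) → Any (OccF q) φs
OccF-⋁⁻ (φ ∷ φs) (∨l o) = here o
OccF-⋁⁻ (φ ∷ φs) (∨r o) = there (OccF-⋁⁻ φs o)

flatten : MF → Fm
flatten (σ ∶ φ) = φ
flatten (A ⋏ B) = flatten A ∧' flatten B
flatten (A ⋎ B) = flatten A ∨' flatten B

module _ (M : Model) (w : W M) where

  ⊨MF-flatten⁺ : ∀ A → M , (λ _ → w) ⊨MF A → M , w ⊩ flatten A
  ⊨MF-flatten⁺ (σ ∶ φ) h = h
  ⊨MF-flatten⁺ (A ⋏ B) (ha , hb) = ⊨MF-flatten⁺ A ha , ⊨MF-flatten⁺ B hb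
  ⊨MF-flatten⁺ (A ⋎ B) (inj₁ h) = inj₁ (⊨MF-flatten⁺ A h)
  ⊨MF-flatten⁺ (A ⋎ B) (inj₂ h) = inj₂ (⊨MF-flatten⁺ B h)

  ⊨MF-flatten⁻ : ∀ A → M , w ⊩ flatten A → M , (λ _ → w) ⊨MF A
  ⊨MF-flatten⁻ (σ ∶ φ) h = h
  ⊨MF-flatten⁻ (A ⋏ B) (ha , hb) = ⊨MF-flatten⁻ A ha , ⊨MF-flatten⁻ B hb
  ⊨MF-flatten⁻ (A ⋎ B) (inj₁ h) = inj₁ (⊨MF-flatten⁻ A h)
  ⊨MF-flatten⁻ (A ⋎ B) (inj₂ h) = inj₂ (⊨MF-flatten⁻ B h)

OccF-flatten⁻ : ∀ {q} A → OccF q (flatten A) → OccMF q A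
OccF-flatten⁻ (σ ∶ φ) o = o
OccF-flatten⁻ (A ⋏ B) (∧l o) = inj₁ (OccF-flatten⁻ A o)
OccF-flatten⁻ (A ⋏ B) (∧r o) = inj₂ (OccF-flatten⁻ B o)
OccF-flatten⁻ (A ⋎ B) (∨l o) = inj₁ (OccF-flatten⁻ A o)
OccF-flatten⁻ (A ⋎ B) (∨r o) = inj₂ (OccF-flatten⁻ B o)

depth : Fm → ℕ
depth (a ∧' b) = depth a ⊔ depth b
depth (a ∨' b) = depth a ⊔ depth b
depth (□ a) = suc (depth a)
depth (◇ a) = suc (depth a)
depth _ = 0

Literal : Set
Literal = Bool × ℕ

literal : Literal → Fm
literal (true , q) = var q
literal (false , q) = nvar q

module _ {M : Model} {w : W M} where

  ⊩-literal⁺ : ∀ {b q} → V M w q ≡ b → M , w ⊩ literal (b , q)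
  ⊩-literal⁺ {true} h = h
  ⊩-literal⁺ {false} h = h

  ⊩-literal⁻ : ∀ {b q} → M , w ⊩ literal (b , q) → V M w q ≡ b
  ⊩-literal⁻ {true} h = h
  ⊩-literal⁻ {false} h = h

OccF-literal⁻ : ∀ {q} li → OccF q (literal li) → q ≡ proj₂ li
OccF-literal⁻ (true , q) ovar = refl
OccF-literal⁻ (false , q) onvar = refl

Refutes : (M : Model) → W M → List Fm → Set
Refutes M w φs = All (λ φ → ¬ M , w ⊩ φ) φs

nested : Seq → List Seq
nested (seq _ Γs) = Γs

-- A path into the tail cs of c ∷ cs, as a path into c ∷ cs.
shiftChild : List ℕ → List ℕ
shiftChild [] = []
shiftChild (m ∷ π) = suc m ∷ π

Everywhere : (List ℕ → Seq → Set) → Seq → Set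
Everywhere P Δ = ∀ {π Δ'} → Sub Δ π Δ' → P π Δ'

InChildren : (List ℕ → Seq → Set) → List Seq → Set
InChildren P Γs = ∀ (k : Fin (length Γs)) → Everywhere (λ π → P (suc (toℕ k) ∷ π)) (lookup Γs k)

Somewhere : (List ℕ → Seq → Set) → Seq → Set
Somewhere P Δ = Σ (List ℕ) λ π → Σ Seq λ Δ' → Sub Δ π Δ' × P π Δ'

InSomeChild : (List ℕ → Seq → Set) → List Seq → Set
InSomeChild P Γs = Σ (Fin (length Γs)) λ k → Somewhere (λ π → P (suc (toℕ k) ∷ π)) (lookup Γs k)

module _ {P : List ℕ → Seq → Set} where

  everywhere-intro : ∀ {Φ Γs} → P [] (seq Φ Γs) → InChildren P Γs → Everywhere P (seq Φ Γs)
  everywhere-intro h hs here = h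
  everywhere-intro h hs (there k s) = hs k s

  everywhere-children : ∀ {Φ Γs} → Everywhere P (seq Φ Γs) → InChildren P Γs
  everywhere-children h k s = h (there k s)

  inChildren-∷ : ∀ {c cs} → Everywhere (λ π → P (1 ∷ π)) c → InChildren (λ π → P (shiftChild π)) cs →
                 InChildren P (c ∷ cs)
  inChildren-∷ h hs zero = h
  inChildren-∷ h hs (suc k) = hs k

  somewhere-child : ∀ {Φ Γs} → InSomeChild P Γs → Somewhere P (seq Φ Γs)
  somewhere-child (k , π , Δ' , s , h) = suc (toℕ k) ∷ π , Δ' , there k s , h

Edge : (M : Model) → (List ℕ → W M) → List ℕ → Seq → Set
Edge M I π Δ = ∀ (k : Fin (length (nested Δ))) → R M (I π) (I (π ++ suc (toℕ k) ∷ []))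

Edges : (M : Model) → (List ℕ → W M) → Seq → Set
Edges M I = Everywhere (Edge M I)

Sub-snoc : ∀ {Γ π Δ} → Sub Γ π Δ → (k : Fin (length (nested Δ))) →
           Sub Γ (π ++ suc (toℕ k) ∷ []) (lookup (nested Δ) k)
Sub-snoc {Δ = seq Φ Γs} here k = there k here
Sub-snoc (there j s) k = there j (Sub-snoc s k)

Sub-there⁻ : ∀ {Φ Γs m π Δ} → Sub (seq Φ Γs) (m ∷ π) Δ →
             Σ (Fin (length Γs)) λ k → m ≡ suc (toℕ k) × Sub (lookup Γs k) π Δ
Sub-there⁻ (there k s) = k , refl , s

Sub-snoc⁻ : ∀ {Γ π n Δ Δ'} → Sub Γ π Δ → Sub Γ (π ++ n ∷ []) Δ' →
            Σ (Fin (length (nested Δ))) λ k → n ≡ suc (toℕ k)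
Sub-snoc⁻ here (there k _) = k , refl
Sub-snoc⁻ (there k s) s' with Sub-there⁻ s'
... | k' , e , s'' with toℕ-injective (suc-injective e)
... | refl = Sub-snoc⁻ s s''

Interp⇒Edges : ∀ {Γ M} (𝓘 : Interp Γ M) → Edges M (λ π → I 𝓘 (1 ∷ π)) Γ
Interp⇒Edges 𝓘 {π} {Δ} s k = edge 𝓘 (1 ∷ π) (suc (toℕ k)) (π , refl , Δ , s) (_ , refl , _ , Sub-snoc s k)

Edges⇒Interp : ∀ {Γ M} (J : List ℕ → W M) → Edges M J Γ → Interp Γ M
Edges⇒Interp {Γ} {M} J E = record { I = J ∘ drop 1 ; edge = edge' }
  where
    edge' : ∀ σ n → IsLabel Γ σ → IsLabel Γ (σ ⋆ n) → R M (J (drop 1 σ)) (J (drop 1 (σ ⋆ n)))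
    edge' .(1 ∷ π) n (π , refl , Δ , s) (_ , e , Δ' , s')
      with Sub-snoc⁻ s (subst (λ ρ → Sub Γ ρ Δ') (sym (∷-injectiveʳ e)) s')
    ... | k , refl = E s k

rooted : ∀ {s} → (ℕ → List ℕ → Pos s) → List ℕ → Pos s
rooted f [] = here
rooted f (m ∷ π) = f m π

DepthBelow : ℕ → List ℕ → Seq → Set
DepthBelow n _ Δ = All (λ φ → depth φ < n) (fmls Δ)

depths : List Fm → ℕ
depths [] = 0
depths (φ ∷ φs) = depth φ ⊔ depths φs

mutual
  depthSeq : Seq → ℕ
  depthSeq (seq Φ Γs) = depths Φ ⊔ depthSeqs Γs

  depthSeqs : List Seq → ℕ
  depthSeqs [] = 0
  depthSeqs (Δ ∷ Γs) = depthSeq Δ ⊔ depthSeqs Γs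

depth≤depths : ∀ {φ} φs → φ ∈ φs → depth φ ≤ depths φs
depth≤depths (φ ∷ φs) (here refl) = m≤m⊔n _ _
depth≤depths (ψ ∷ φs) (there m) = ≤-trans (depth≤depths φs m) (m≤n⊔m _ _)

depthSeq≤depthSeqs : ∀ Γs (k : Fin (length Γs)) → depthSeq (lookup Γs k) ≤ depthSeqs Γs
depthSeq≤depthSeqs (Δ ∷ Γs) zero = m≤m⊔n _ _
depthSeq≤depthSeqs (Δ ∷ Γs) (suc k) = ≤-trans (depthSeq≤depthSeqs Γs k) (m≤n⊔m _ _)

depthSeq-bound : ∀ Γ → Everywhere (DepthBelow (suc (depthSeq Γ))) Γ
depthSeq-bound (seq Φ Γs) here = All.tabulate (λ m → s≤s (≤-trans (depth≤depths Φ m) (m≤m⊔n _ _)))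
depthSeq-bound (seq Φ Γs) (there k s) =
  All.map (λ d → ≤-trans d (s≤s (≤-trans (depthSeq≤depthSeqs Γs k) (m≤n⊔m _ _)))) (depthSeq-bound (lookup Γs k) s)

-- Saturation by the invertible rules

record Residue : Set where
  constructor residue
  field
    literals : List Literal
    diamonds : List Fm
    boxes : List Fm

open Residue

∅ : Residue
∅ = residue [] [] []

addLiteral : Literal → Residue → Residue
addLiteral li r = record r { literals = li ∷ literals r }

addDiamond : Fm → Residue → Residue
addDiamond a r = record r { diamonds = a ∷ diamonds r }

addBox : Fm → Residue → Residue
addBox a r = record r { boxes = a ∷ boxes r }

saturate : Logic → Label → Fm → (Residue → MF) → Residue → MF
saturate l σ ⊥' k = k
saturate l σ ⊤' k r = σ ∶ ⊤'
saturate l σ (var q) k r = k (addLiteral (true , q) r)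
saturate l σ (nvar q) k r = k (addLiteral (false , q) r)
saturate l σ (a ∨' b) k = saturate l σ a (saturate l σ b k)
saturate l σ (a ∧' b) k r = saturate l σ a k r ⋏ saturate l σ b k r
saturate l σ (□ a) k r = k (addBox a r)
saturate D σ (◇ a) k r = k (addDiamond a r)
saturate T σ (◇ a) k r = saturate T σ a k (addDiamond a r)

saturateAll : Logic → Label → List Fm → (Residue → MF) → Residue → MF
saturateAll l σ φs k = foldr (saturate l σ) k φs

module _ (L : Label → Set) where

  saturate-labels : ∀ l {σ} φ {k} → L σ → (∀ r → AllLabels L (k r)) → ∀ r → AllLabels L (saturate l σ φ k r)
  saturate-labels l ⊥' hσ hk = hk
  saturate-labels l ⊤' hσ hk r = hσ
  saturate-labels l (var q) hσ hk r = hk _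
  saturate-labels l (nvar q) hσ hk r = hk _
  saturate-labels l (a ∨' b) hσ hk = saturate-labels l a hσ (saturate-labels l b hσ hk)
  saturate-labels l (a ∧' b) hσ hk r = saturate-labels l a hσ hk r , saturate-labels l b hσ hk r
  saturate-labels l (□ a) hσ hk r = hk _
  saturate-labels D (◇ a) hσ hk r = hk _
  saturate-labels T (◇ a) hσ hk r = saturate-labels T a hσ hk _

  saturateAll-labels : ∀ l {σ} φs {k} → L σ → (∀ r → AllLabels L (k r)) →
                       ∀ r → AllLabels L (saturateAll l σ φs k r)
  saturateAll-labels l [] hσ hk = hk
  saturateAll-labels l (φ ∷ φs) hσ hk = saturate-labels l φ hσ (saturateAll-labels l φs hσ hk)

VarsIn : (ℕ → Set) → Fm → Set
VarsIn P φ = ∀ q → OccF q φ → P q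

ResidueVarsIn : (ℕ → Set) → Residue → Set
ResidueVarsIn P r = All (λ li → P (proj₂ li)) (literals r) × All (VarsIn P) (diamonds r) × All (VarsIn P) (boxes r)

UsesOnly : (ℕ → Set) → ℕ → MF → Set
UsesOnly P p A = ∀ q → OccMF q A → P q × q ≢ p

module _ (P : ℕ → Set) (p : ℕ) where

  saturate-vars : ∀ l {σ} φ {k} → VarsIn P φ → (∀ r → ResidueVarsIn P r → UsesOnly P p (k r)) →
                  ∀ r → ResidueVarsIn P r → UsesOnly P p (saturate l σ φ k r)
  saturate-vars l ⊥' hφ hk = hk
  saturate-vars l ⊤' hφ hk r hr q ()
  saturate-vars l (var x) hφ hk r (hl , hd , hb) = hk _ (hφ x ovar ∷ hl , hd , hb)
  saturate-vars l (nvar x) hφ hk r (hl , hd , hb) = hk _ (hφ x onvar ∷ hl , hd , hb)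
  saturate-vars l (a ∨' b) hφ hk =
    saturate-vars l a (λ q o → hφ q (∨l o)) (saturate-vars l b (λ q o → hφ q (∨r o)) hk)
  saturate-vars l (a ∧' b) hφ hk r hr q (inj₁ o) = saturate-vars l a (λ q o → hφ q (∧l o)) hk r hr q o
  saturate-vars l (a ∧' b) hφ hk r hr q (inj₂ o) = saturate-vars l b (λ q o → hφ q (∧r o)) hk r hr q o
  saturate-vars l (□ a) hφ hk r (hl , hd , hb) = hk _ (hl , hd , (λ q o → hφ q (o□ o)) ∷ hb)
  saturate-vars D (◇ a) hφ hk r (hl , hd , hb) = hk _ (hl , (λ q o → hφ q (o◇ o)) ∷ hd , hb)
  saturate-vars T (◇ a) hφ hk r (hl , hd , hb) =
    saturate-vars T a (λ q o → hφ q (o◇ o)) hk _ (hl , (λ q o → hφ q (o◇ o)) ∷ hd , hb)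

  saturateAll-vars : ∀ l {σ} φs {k} → All (VarsIn P) φs → (∀ r → ResidueVarsIn P r → UsesOnly P p (k r)) →
                     ∀ r → ResidueVarsIn P r → UsesOnly P p (saturateAll l σ φs k r)
  saturateAll-vars l [] hφs hk = hk
  saturateAll-vars l (φ ∷ φs) (hφ ∷ hφs) hk = saturate-vars l φ hφ (saturateAll-vars l φs hφs hk)

module _ {t : Tree} where

  Residue⊩ : Logic → Pos t → Residue → Set
  Residue⊩ l x r = Any (λ li → model l t , x ⊩ literal li) (literals r)
                 ⊎ Any (λ a → model l t , x ⊩ ◇ a) (diamonds r)
                 ⊎ Any (λ a → model l t , x ⊩ □ a) (boxes r)

  module _ (l : Logic) {x : Pos t} {r : Residue} where

    Residue⊩-addLiteral : ∀ {li} → Residue⊩ l x (addLiteral li r) → model l t , x ⊩ literal li ⊎ Residue⊩ l x r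
    Residue⊩-addLiteral (inj₁ (here h)) = inj₁ h
    Residue⊩-addLiteral (inj₁ (there h)) = inj₂ (inj₁ h)
    Residue⊩-addLiteral (inj₂ h) = inj₂ (inj₂ h)

    Residue⊩-addDiamond : ∀ {a} → Residue⊩ l x (addDiamond a r) → model l t , x ⊩ ◇ a ⊎ Residue⊩ l x r
    Residue⊩-addDiamond (inj₂ (inj₁ (here h))) = inj₁ h
    Residue⊩-addDiamond (inj₂ (inj₁ (there h))) = inj₂ (inj₂ (inj₁ h))
    Residue⊩-addDiamond (inj₁ h) = inj₂ (inj₁ h)
    Residue⊩-addDiamond (inj₂ (inj₂ h)) = inj₂ (inj₂ (inj₂ h))

    Residue⊩-addBox : ∀ {a} → Residue⊩ l x (addBox a r) → model l t , x ⊩ □ a ⊎ Residue⊩ l x r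
    Residue⊩-addBox (inj₂ (inj₂ (here h))) = inj₁ h
    Residue⊩-addBox (inj₂ (inj₂ (there h))) = inj₂ (inj₂ (inj₂ h))
    Residue⊩-addBox (inj₁ h) = inj₂ (inj₁ h)
    Residue⊩-addBox (inj₂ (inj₁ h)) = inj₂ (inj₂ (inj₁ h))

module _ {t : Tree} (I : Label → Pos t) where

  -- G is what the continuation may establish instead of the residue; the ∨ case uses it
  -- to carry the second disjunct.
  saturate-sound : ∀ l {σ} φ {k} {G : Set} → (∀ r → model l t , I ⊨MF k r → Residue⊩ l (I σ) r ⊎ G) →
                   ∀ r → model l t , I ⊨MF saturate l σ φ k r → (model l t , I σ ⊩ φ ⊎ Residue⊩ l (I σ) r) ⊎ G
  saturate-sound l ⊥' hk r h = Sum.map₁ inj₂ (hk r h)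
  saturate-sound l ⊤' hk r h = inj₁ (inj₁ tt)
  saturate-sound l (var q) hk r h = Sum.map₁ (Residue⊩-addLiteral l) (hk _ h)
  saturate-sound l (nvar q) hk r h = Sum.map₁ (Residue⊩-addLiteral l) (hk _ h)
  saturate-sound l {σ} (a ∨' b) {k} {G} hk r h with saturate-sound l a hk' r h
    where
      hk' : ∀ r → model l t , I ⊨MF saturate l σ b k r → Residue⊩ l (I σ) r ⊎ (model l t , I σ ⊩ b ⊎ G)
      hk' r h = Sum.[ Sum.[ inj₂ ∘ inj₁ , inj₁ ]′ , inj₂ ∘ inj₂ ]′ (saturate-sound l b hk r h)
  ... | inj₁ (inj₁ x) = inj₁ (inj₁ (inj₁ x))
  ... | inj₁ (inj₂ o) = inj₁ (inj₂ o)
  ... | inj₂ (inj₁ x) = inj₁ (inj₁ (inj₂ x))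
  ... | inj₂ (inj₂ g) = inj₂ g
  saturate-sound l (a ∧' b) hk r (ha , hb) with saturate-sound l a hk r ha | saturate-sound l b hk r hb
  ... | inj₁ (inj₁ x) | inj₁ (inj₁ y) = inj₁ (inj₁ (x , y))
  ... | inj₁ (inj₂ o) | _ = inj₁ (inj₂ o)
  ... | inj₂ g | _ = inj₂ g
  ... | inj₁ (inj₁ _) | inj₁ (inj₂ o) = inj₁ (inj₂ o)
  ... | inj₁ (inj₁ _) | inj₂ g = inj₂ g
  saturate-sound l (□ a) hk r h = Sum.map₁ (Residue⊩-addBox l) (hk _ h)
  saturate-sound D (◇ a) hk r h = Sum.map₁ (Residue⊩-addDiamond D) (hk _ h)
  saturate-sound T (◇ a) hk r h =
    Sum.map₁ Sum.[ inj₁ ∘ ◇-refl T (I _) tt , Residue⊩-addDiamond T ]′ (saturate-sound T a hk _ h)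

  saturateAll-sound : ∀ l {σ} φs {k} {G : Set} → (∀ r → model l t , I ⊨MF k r → Residue⊩ l (I σ) r ⊎ G) →
                      ∀ r → model l t , I ⊨MF saturateAll l σ φs k r →
                      (Any (λ φ → model l t , I σ ⊩ φ) φs ⊎ Residue⊩ l (I σ) r) ⊎ G
  saturateAll-sound l [] hk r h = Sum.map₁ inj₂ (hk r h)
  saturateAll-sound l {σ} (φ ∷ φs) {k} {G} hk r h with saturate-sound l φ hk' r h
    where
      hk' : ∀ r → model l t , I ⊨MF saturateAll l σ φs k r →
            Residue⊩ l (I σ) r ⊎ (Any (λ φ → model l t , I σ ⊩ φ) φs ⊎ G)
      hk' r h = Sum.[ Sum.[ inj₂ ∘ inj₁ , inj₁ ]′ , inj₂ ∘ inj₂ ]′ (saturateAll-sound l φs hk r h)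
  ... | inj₁ (inj₁ x) = inj₁ (inj₁ (here x))
  ... | inj₁ (inj₂ o) = inj₁ (inj₂ o)
  ... | inj₂ (inj₁ a) = inj₁ (inj₁ (there a))
  ... | inj₂ (inj₂ g) = inj₂ g

ResidueDepthBelow : ℕ → Residue → Set
ResidueDepthBelow n r = All (λ a → depth (◇ a) < n) (diamonds r) × All (λ a → depth (□ a) < n) (boxes r)

-- The alternative v ≡ w lets a reflexive world refute ◇ a through a refutation
-- of a at w itself, which the t-rule provides separately.
RefutesResidue : Logic → (s : Tree) → Pos s → Residue → Set
RefutesResidue l s w r =
    All (λ li → ¬ model l s , w ⊩ literal li) (literals r)
  × All (λ a → ∀ v → Accessible l s w v → ¬ (model l s , v ⊩ a) ⊎ (v ≡ w × IsReflexive l)) (diamonds r)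
  × All (λ a → ¬ model l s , w ⊩ □ a) (boxes r)

module _ {t₀ : Tree} (I : Label → Pos t₀) (n : ℕ) where

  Refines : Logic → (Residue → MF) → (∀ {s} → Pos s → Set) → Residue → Set
  Refines l k Q r = Σ Residue λ r' → ResidueDepthBelow n r' × ¬ (model l t₀ , I ⊨MF k r') ×
    (∀ {s} (w : Pos s) → RefutesResidue l s w r' → Q w × RefutesResidue l s w r)

  saturate-complete : ∀ l {σ} φ {k} r → ResidueDepthBelow n r → depth φ < n →
                      ¬ (model l t₀ , I ⊨MF saturate l σ φ k r) →
                      Refines l k (λ {s} w → ¬ (model l s , w ⊩ φ)) r
  saturate-complete l ⊥' r b dφ nh = r , b , nh , λ w ref → (λ ()) , ref
  saturate-complete l ⊤' r b dφ nh = ⊥-elim (nh tt)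
  saturate-complete l (var q) r b dφ nh = _ , b , nh , λ { w (nl ∷ nls , nd , nb) → nl , (nls , nd , nb) }
  saturate-complete l (nvar q) r b dφ nh = _ , b , nh , λ { w (nl ∷ nls , nd , nb) → nl , (nls , nd , nb) }
  saturate-complete l (a ∨' b) r bd dφ nh
    with saturate-complete l a r bd (m⊔n<o⇒m<o (depth a) (depth b) dφ) nh
  ... | r₁ , bd₁ , nh₁ , ref₁ with saturate-complete l b r₁ bd₁ (m⊔n<o⇒n<o (depth a) (depth b) dφ) nh₁
  ...   | r₂ , bd₂ , nh₂ , ref₂ = r₂ , bd₂ , nh₂ , λ w ref →
          let nb , ref' = ref₂ w ref ; na , ref'' = ref₁ w ref' in Sum.[ na , nb ]′ , ref''
  saturate-complete l (a ∧' b) {k} r bd dφ nh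
    with ⊨MF-dec (model l t₀) I (⊩-dec l) (saturate l _ a k r)
  ... | no na = let r' , bd' , nh' , ref = saturate-complete l a r bd (m⊔n<o⇒m<o (depth a) (depth b) dφ) na
                in r' , bd' , nh' , λ w ref' → let ¬a , ref'' = ref w ref' in ¬a ∘ proj₁ , ref''
  ... | yes ya = let r' , bd' , nh' , ref = saturate-complete l b r bd (m⊔n<o⇒n<o (depth a) (depth b) dφ) (nh ∘ (ya ,_))
                 in r' , bd' , nh' , λ w ref' → let ¬b , ref'' = ref w ref' in ¬b ∘ proj₂ , ref''
  saturate-complete l (□ a) r (bd , bb) dφ nh =
    _ , (bd , dφ ∷ bb) , nh , λ { w (nl , nd , nb ∷ nbs) → nb , (nl , nd , nbs) }
  saturate-complete D (◇ a) r (bd , bb) dφ nh = _ , (dφ ∷ bd , bb) , nh , λ { w (nl , nd ∷ nds , nb) →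
    (λ { (v , rv , hv) → Sum.[ (λ ¬a → ¬a hv) , (λ ()) ∘ proj₂ ]′ (nd v rv) }) , (nl , nds , nb) }
  saturate-complete T (◇ a) r (bd , bb) dφ nh
    with saturate-complete T a (addDiamond a r) (dφ ∷ bd , bb) (≤-trans (n≤1+n _) dφ) nh
  ... | r' , bd' , nh' , ref = r' , bd' , nh' , λ w ref' → refute-◇ w (ref w ref')
    where
      refute-◇ : ∀ {s} (w : Pos s) → ¬ (model T s , w ⊩ a) × RefutesResidue T s w (addDiamond a r) →
                 ¬ (model T s , w ⊩ ◇ a) × RefutesResidue T s w r
      refute-◇ w (¬a , nl , nd ∷ nds , nb) =
        (λ { (v , rv , hv) → Sum.[ (λ ¬a' → ¬a' hv) , (λ { (refl , _) → ¬a hv }) ]′ (nd v rv) }) , (nl , nds , nb)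

  saturateAll-complete : ∀ l {σ} φs {k} r → ResidueDepthBelow n r → All (λ φ → depth φ < n) φs →
                         ¬ (model l t₀ , I ⊨MF saturateAll l σ φs k r) →
                         Refines l k (λ {s} w → Refutes (model l s) w φs) r
  saturateAll-complete l [] r bd dφs nh = r , bd , nh , λ w ref → [] , ref
  saturateAll-complete l (φ ∷ φs) r bd (dφ ∷ dφs) nh with saturate-complete l φ r bd dφ nh
  ... | r₁ , bd₁ , nh₁ , ref₁ with saturateAll-complete l φs r₁ bd₁ dφs nh₁
  ...   | r₂ , bd₂ , nh₂ , ref₂ = r₂ , bd₂ , nh₂ , λ w ref →
          let nφs , ref' = ref₂ w ref ; nφ , ref'' = ref₁ w ref' in nφ ∷ nφs , ref''

-- The interpolant

module Interpolant (l : Logic) (p : ℕ) where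

  -- ⊤ iff both p and p̄ occur, i.e. iff an identity axiom on p applies.
  pAxiom : List Literal → Fm
  pAxiom ls with (true , p) ∈? ls | (false , p) ∈? ls
  ... | yes _ | yes _ = ⊤'
  ... | _ | _ = ⊥'

  pFree : List Literal → List Literal
  pFree = filter (λ li → ¬? (proj₂ li ≟ p))

  literalsFormula : List Literal → Fm
  literalsFormula ls = ⋁ (map literal (pFree ls)) ∨' pAxiom ls

  -- ui n Δ H lab interpolates Δ with H added at its root, to modal depth n;
  -- lab maps the paths of Δ to labels of the enclosing sequent.
  mutual
    ui : ℕ → Seq → List Fm → (List ℕ → Label) → MF
    ui n (seq Φ Γs) H lab = saturateAll l (lab []) (H ++ Φ) (uiNode n Γs lab) ∅

    uiNode : ℕ → List Seq → (List ℕ → Label) → Residue → MF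
    uiNode n Γs lab r = (lab [] ∶ localFormula n r) ⋎ uiChildren n (diamonds r) Γs lab

    localFormula : ℕ → Residue → Fm
    localFormula zero r = literalsFormula (literals r)
    localFormula (suc n) r =
      literalsFormula (literals r) ∨'
      (◇ (uiFormula n (diamonds r)) ∨' ⋁ (map (λ a → □ (uiFormula n (a ∷ diamonds r))) (boxes r)))

    uiChildren : ℕ → List Fm → List Seq → (List ℕ → Label) → MF
    uiChildren n ds [] lab = lab [] ∶ ⊥'
    uiChildren n ds (c ∷ cs) lab = ui n c ds (λ π → lab (1 ∷ π)) ⋎ uiChildren n ds cs (λ π → lab (shiftChild π))

    uiFormula : ℕ → List Fm → Fm
    uiFormula n Ψ = flatten (ui n (seq Ψ []) [] (λ _ → 1 ∷ []))

  module _ (L : Label → Set) where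

    mutual
      ui-labels : ∀ n Δ H lab → Everywhere (λ π _ → L (lab π)) Δ → AllLabels L (ui n Δ H lab)
      ui-labels n (seq Φ Γs) H lab h =
        saturateAll-labels L l (H ++ Φ) (h here)
          (λ r → h here , uiChildren-labels n (diamonds r) Γs lab (h here) (everywhere-children h)) ∅

      uiChildren-labels : ∀ n ds Γs lab → L (lab []) → InChildren (λ π _ → L (lab π)) Γs →
                          AllLabels L (uiChildren n ds Γs lab)
      uiChildren-labels n ds [] lab h0 hs = h0
      uiChildren-labels n ds (c ∷ cs) lab h0 hs =
        ui-labels n c ds _ (hs zero) , uiChildren-labels n ds cs _ h0 (λ k → hs (suc k))

  module _ (P : ℕ → Set) where

    pAxiom-closed : ∀ {q} ls → ¬ OccF q (pAxiom ls)
    pAxiom-closed ls o with (true , p) ∈? ls | (false , p) ∈? ls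
    pAxiom-closed ls () | yes _ | yes _
    pAxiom-closed ls () | yes _ | no _
    pAxiom-closed ls () | no _ | _

    literalsFormula-vars : ∀ {q} ls → All (λ li → P (proj₂ li)) ls → OccF q (literalsFormula ls) → P q × q ≢ p
    literalsFormula-vars ls hs (∨l o) with find (Any.map⁻ (OccF-⋁⁻ (map literal (pFree ls)) o))
    ... | li , m , o' with ∈-filter⁻ (λ li → ¬? (proj₂ li ≟ p)) {xs = ls} m | OccF-literal⁻ li o'
    ...   | m' , q≢p | refl = All.lookup hs m' , q≢p
    literalsFormula-vars ls hs (∨r o) = ⊥-elim (pAxiom-closed ls o)

    mutual
      ui-vars : ∀ n Δ H lab → All (VarsIn P) H → Everywhere (λ _ Δ' → All (VarsIn P) (fmls Δ')) Δ →
                UsesOnly P p (ui n Δ H lab)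
      ui-vars n (seq Φ Γs) H lab hH hΔ =
        saturateAll-vars P p l (H ++ Φ) (All.++⁺ hH (hΔ here)) (uiNode-vars n Γs lab (everywhere-children hΔ))
          ∅ ([] , [] , [])

      uiNode-vars : ∀ n Γs lab → InChildren (λ _ Δ' → All (VarsIn P) (fmls Δ')) Γs →
                    ∀ r → ResidueVarsIn P r → UsesOnly P p (uiNode n Γs lab r)
      uiNode-vars n Γs lab hs r hr q (inj₁ o) = localFormula-vars n r hr o
      uiNode-vars n Γs lab hs r (_ , hd , _) q (inj₂ o) = uiChildren-vars n _ Γs lab hd hs q o

      localFormula-vars : ∀ n r → ResidueVarsIn P r → ∀ {q} → OccF q (localFormula n r) → P q × q ≢ p
      localFormula-vars zero r (hl , _) o = literalsFormula-vars (literals r) hl o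
      localFormula-vars (suc n) r (hl , _) (∨l o) = literalsFormula-vars (literals r) hl o
      localFormula-vars (suc n) r (_ , hd , _) (∨r (∨l (o◇ o))) = uiFormula-vars n _ hd o
      localFormula-vars (suc n) r (_ , hd , hb) (∨r (∨r o))
        with find (Any.map⁻ (OccF-⋁⁻ (map (λ a → □ (uiFormula n (a ∷ diamonds r))) (boxes r)) o))
      ... | a , m , o□ o' = uiFormula-vars n (a ∷ diamonds r) (All.lookup hb m ∷ hd) o'

      uiChildren-vars : ∀ n ds Γs lab → All (VarsIn P) ds → InChildren (λ _ Δ' → All (VarsIn P) (fmls Δ')) Γs →
                        UsesOnly P p (uiChildren n ds Γs lab)
      uiChildren-vars n ds [] lab hd hs q ()
      uiChildren-vars n ds (c ∷ cs) lab hd hs q (inj₁ o) = ui-vars n c ds _ hd (hs zero) q o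
      uiChildren-vars n ds (c ∷ cs) lab hd hs q (inj₂ o) = uiChildren-vars n ds cs _ hd (λ k → hs (suc k)) q o

      uiFormula-vars : ∀ n Ψ → All (VarsIn P) Ψ → ∀ {q} → OccF q (uiFormula n Ψ) → P q × q ≢ p
      uiFormula-vars n Ψ hΨ {q} o = ui-vars n (seq Ψ []) [] (λ _ → 1 ∷ []) [] (λ { here → hΨ }) q (OccF-flatten⁻ _ o)

  module _ {t : Tree} where

    private
      M : Model
      M = model l t

    pAxiom-sound : ∀ {x : Pos t} ls → M , x ⊩ pAxiom ls → Any (λ li → M , x ⊩ literal li) ls
    pAxiom-sound {x} ls h with (true , p) ∈? ls | (false , p) ∈? ls
    pAxiom-sound {x} ls h | yes m₁ | yes m₀ with val (subtree x) p in e
    ... | true = lose m₁ (⊩-literal⁺ {M = M} {w = x} e)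
    ... | false = lose m₀ (⊩-literal⁺ {M = M} {w = x} e)
    pAxiom-sound ls () | yes _ | no _
    pAxiom-sound ls () | no _ | _

    literalsFormula-sound : ∀ {x : Pos t} ls → M , x ⊩ literalsFormula ls → Any (λ li → M , x ⊩ literal li) ls
    literalsFormula-sound ls (inj₁ h) = Any.filter⁻ (λ li → ¬? (proj₂ li ≟ p)) (Any.map⁻ (⊩-⋁⁻ _ h))
    literalsFormula-sound ls (inj₂ h) = pAxiom-sound ls h

    SomeFormulaTrue : (Label → Pos t) → (List ℕ → Label) → List ℕ → Seq → Set
    SomeFormulaTrue I lab π Δ = Any (λ φ → M , I (lab π) ⊩ φ) (fmls Δ)

    mutual
      ui-sound : ∀ n Δ H lab (I : Label → Pos t) → Edges M (I ∘ lab) Δ → M , I ⊨MF ui n Δ H lab →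
                 Any (λ φ → M , I (lab []) ⊩ φ) H ⊎ Somewhere (SomeFormulaTrue I lab) Δ
      ui-sound n (seq Φ Γs) H lab I E h
        with saturateAll-sound I l (H ++ Φ) (uiNode-sound n Γs lab I (E here) (everywhere-children E)) ∅ h
      ... | inj₁ (inj₁ a) = Sum.map₂ (λ a → [] , _ , here , a) (Any.++⁻ H a)
      ... | inj₁ (inj₂ (inj₁ ()))
      ... | inj₁ (inj₂ (inj₂ (inj₁ ())))
      ... | inj₁ (inj₂ (inj₂ (inj₂ ())))
      ... | inj₂ g = inj₂ (somewhere-child g)

      uiNode-sound : ∀ n Γs lab I → Edge M (I ∘ lab) [] (seq [] Γs) → InChildren (Edge M (I ∘ lab)) Γs →
                     ∀ r → M , I ⊨MF uiNode n Γs lab r →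
                     Residue⊩ l (I (lab [])) r ⊎ InSomeChild (SomeFormulaTrue I lab) Γs
      uiNode-sound n Γs lab I e₀ es r (inj₁ h) = inj₁ (localFormula-sound n r h)
      uiNode-sound n Γs lab I e₀ es r (inj₂ h) =
        Sum.map₁ (inj₂ ∘ inj₁) (uiChildren-sound n (diamonds r) Γs lab I e₀ es h)

      uiChildren-sound : ∀ n ds Γs lab I → Edge M (I ∘ lab) [] (seq [] Γs) → InChildren (Edge M (I ∘ lab)) Γs →
                         M , I ⊨MF uiChildren n ds Γs lab →
                         Any (λ a → M , I (lab []) ⊩ ◇ a) ds ⊎ InSomeChild (SomeFormulaTrue I lab) Γs
      uiChildren-sound n ds (c ∷ cs) lab I e₀ es (inj₁ h) with ui-sound n c ds _ I (es zero) h
      ... | inj₁ a = inj₁ (Any.map (λ h → _ , e₀ zero , h) a)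
      ... | inj₂ sw = inj₂ (zero , sw)
      uiChildren-sound n ds (c ∷ cs) lab I e₀ es (inj₂ h)
        with uiChildren-sound n ds cs _ I (λ k → e₀ (suc k)) (λ k → es (suc k)) h
      ... | inj₁ a = inj₁ a
      ... | inj₂ (k , sw) = inj₂ (suc k , sw)

      localFormula-sound : ∀ n r {x} → M , x ⊩ localFormula n r → Residue⊩ l x r
      localFormula-sound zero r h = inj₁ (literalsFormula-sound _ h)
      localFormula-sound (suc n) r (inj₁ h) = inj₁ (literalsFormula-sound _ h)
      localFormula-sound (suc n) r (inj₂ (inj₁ (v , rv , hv))) =
        inj₂ (inj₁ (Any.map (λ h → v , rv , h) (uiFormula-sound n _ v hv)))
      localFormula-sound (suc n) r {x} (inj₂ (inj₂ h)) with find (Any.map⁻ (⊩-⋁⁻ _ h))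
      ... | a , m , h□ =
        Sum.[ (λ h → inj₂ (inj₂ (lose m h))) , inj₂ ∘ inj₁ ]′ (box-or-diamond n a (diamonds r) x h□)

      box-or-diamond : ∀ n a ds x → M , x ⊩ □ (uiFormula n (a ∷ ds)) →
                       M , x ⊩ □ a ⊎ Any (λ d → M , x ⊩ ◇ d) ds
      box-or-diamond n a ds x h with ⊩-dec l x (□ a)
      ... | yes h□ = inj₁ h□
      ... | no n□ with ¬□⇒◇¬ l x (λ y → ⊩-dec l y a) n□
      ...   | v , rv , ¬a with uiFormula-sound n (a ∷ ds) v (h v rv)
      ...     | here ha = ⊥-elim (¬a ha)
      ...     | there hd = inj₂ (Any.map (λ h → v , rv , h) hd)

      uiFormula-sound : ∀ n Ψ (v : Pos t) → M , v ⊩ uiFormula n Ψ → Any (λ φ → M , v ⊩ φ) Ψ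
      uiFormula-sound n Ψ v h
        with ui-sound n (seq Ψ []) [] (λ _ → 1 ∷ []) (λ _ → v) (λ { here () ; (there () _) })
               (⊨MF-flatten⁻ M v (ui n (seq Ψ []) [] (λ _ → 1 ∷ [])) h)
      ... | inj₂ (_ , _ , here , a) = a

  module _ {t₀ : Tree} where

    private
      M₀ : Model
      M₀ = model l t₀

    record Refutation (y : Pos t₀) (Ψ : List Fm) (s : Tree) : Set₁ where
      field
        bisim : BisimUpTo p (model l s) M₀
        related : Z bisim here y
        refutes : Refutes (model l s) here Ψ

    record Piece (x : Pos t₀) (ds : List Fm) (s : Tree) : Set₁ where
      field
        target : Pos t₀
        edge : Accessible l t₀ x target
        refutation : Refutation target ds s
      open Refutation refutation public

    -- Only the worlds below the root are stored, so that J [] ≡ here holds by definition.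
    record Countermodel (I : List ℕ → Pos t₀) (Γs : List Seq) : Set₁ where
      field
        tree : Tree
        below : ℕ → List ℕ → Pos tree
      J : List ℕ → Pos tree
      J = rooted below
      field
        bisim : BisimUpTo p (model l tree) M₀
        root-related : Z bisim here (I [])
        root-edges : Edge (model l tree) J [] (seq [] Γs)
        children-related : InChildren (λ π _ → Z bisim (J π) (I π)) Γs
        children-edges : InChildren (Edge (model l tree) J) Γs
        children-refuted : InChildren (λ π Δ → Refutes (model l tree) (J π) (fmls Δ)) Γs

    SequentCountermodel : (List ℕ → Pos t₀) → Seq → List Fm → Set₁
    SequentCountermodel I Δ H =
      Σ (Countermodel I (nested Δ)) λ c → Refutes (model l (Countermodel.tree c)) here (H ++ fmls Δ)

    module _ {I : List ℕ → Pos t₀} {H : List Fm} where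
      open Countermodel

      related-everywhere : ∀ {Δ} ((c , _) : SequentCountermodel I Δ H) →
                           Everywhere (λ π _ → Z (bisim c) (J c π) (I π)) Δ
      related-everywhere {seq Φ Γs} (c , _) =
        everywhere-intro {P = λ π _ → Z (bisim c) (J c π) (I π)} (root-related c) (children-related c)

      edges-everywhere : ∀ {Δ} ((c , _) : SequentCountermodel I Δ H) → Edges (model l (tree c)) (J c) Δ
      edges-everywhere {seq Φ Γs} (c , _) =
        everywhere-intro {P = Edge (model l (tree c)) (J c)} (root-edges c) (children-edges c)

      refuted-everywhere : ∀ {Δ} ((c , _) : SequentCountermodel I Δ H) →
                           Everywhere (λ π Δ' → Refutes (model l (tree c)) (J c π) (fmls Δ')) Δ
      refuted-everywhere {seq Φ Γs} (c , ref) =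
        everywhere-intro {P = λ π Δ' → Refutes (model l (tree c)) (J c π) (fmls Δ')} (All.++⁻ʳ H ref) (children-refuted c)

    module Glue (x : Pos t₀) (ds : List Fm) where

      Pieces : Set₁
      Pieces = List (Σ Tree (Piece x ds))

      trees : Pieces → List Tree
      trees = map proj₁

      pieceAt : (L : Pieces) (k : Fin (length (trees L))) → Piece x ds (lookup (trees L) k)
      pieceAt ((s , pc) ∷ L) zero = pc
      pieceAt (_ ∷ L) (suc k) = pieceAt L k

      Located : Pieces → (s : Tree) → Piece x ds s → Set₁
      Located L s pc = Σ (Fin (length (trees L))) λ k →
                       Σ (lookup (trees L) k ≡ s) λ eq → subst (Piece x ds) eq (pieceAt L k) ≡ pc

      locate : ∀ (L : Pieces) {s pc} → (s , pc) ∈ L → Located L s pc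
      locate (_ ∷ L) (here refl) = zero , refl , refl
      locate (_ ∷ L) (there m) = let k , eq , eq' = locate L m in suc k , eq , eq'

      data ChildCountermodels : (List ℕ → Pos t₀) → List Seq → Set₁ where
        [] : ∀ {I} → ChildCountermodels I []
        _∷_ : ∀ {I c cs} → Accessible l t₀ x (I (1 ∷ [])) × SequentCountermodel (λ π → I (1 ∷ π)) c ds →
              ChildCountermodels (λ π → I (shiftChild π)) cs → ChildCountermodels I (c ∷ cs)

      childPieces : ∀ {I Γs} → ChildCountermodels I Γs → Pieces
      childPieces [] = []
      childPieces ((e , c , ref) ∷ cms) =
        (tree c , record { target = _ ; edge = e
                         ; refutation = record { bisim = bisim c ; related = root-related c ; refutes = All.++⁻ˡ ds ref } })
        ∷ childPieces cms
        where open Countermodel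

      module Over (v : ℕ → Bool) (L : Pieces) where

        glued : Tree
        glued = node v (trees L)

        embedPiece : ∀ {s pc} → Located L s pc → Pos s → Pos glued
        embedPiece (k , refl , refl) = down k

        R-embedPiece : ∀ {s pc} (loc : Located L s pc) {q q'} → Accessible l s q q' →
                       Accessible l glued (embedPiece loc q) (embedPiece loc q')
        R-embedPiece (k , refl , refl) = R-embed⁺ l (down k here)

        R-root-embedPiece : ∀ {s pc} (loc : Located L s pc) → Accessible l glued here (embedPiece loc here)
        R-root-embedPiece (k , refl , refl) = R-root-child l k

        ⊩-embedPiece⁻ : ∀ {s pc} (loc : Located L s pc) q φ →
                        model l glued , embedPiece loc q ⊩ φ → model l s , q ⊩ φ
        ⊩-embedPiece⁻ (k , refl , refl) = ⊩-embed⁻ l (down k here)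

        GlueZ : Pos glued → Pos t₀ → Set
        GlueZ here w = w ≡ x
        GlueZ (down k q) w = Z (Piece.bisim (pieceAt L k)) q w

        GlueZ-embedPiece : ∀ {s pc} (loc : Located L s pc) {q w} → Z (Piece.bisim pc) q w → GlueZ (embedPiece loc q) w
        GlueZ-embedPiece (k , refl , refl) z = z

        Covers : Set
        Covers = ∀ y → Accessible l t₀ x y → Σ (Fin (length (trees L))) λ k → Z (Piece.bisim (pieceAt L k)) here y

        located-covers : ∀ {s pc} → Located L s pc → ∀ {y} → Z (Piece.bisim pc) here y →
                         Σ (Fin (length (trees L))) λ k → Z (Piece.bisim (pieceAt L k)) here y
        located-covers (k , refl , refl) z = k , z

        glue-bisim : (∀ q → q ≢ p → v q ≡ val (subtree x) q) → Covers → BisimUpTo p (model l glued) M₀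
        glue-bisim agree covers = record { Z = GlueZ ; atoms = λ {w} {w'} → atoms' {w} {w'} ; forth = forth' ; back = back' }
          where
            atoms' : ∀ {w w'} → GlueZ w w' → ∀ q → q ≢ p → val (subtree w) q ≡ val (subtree w') q
            atoms' {here} refl = agree
            atoms' {down k q} z = atoms (Piece.bisim (pieceAt L k)) z

            forth' : ∀ {w w' u} → GlueZ w w' → Accessible l glued w u →
                     Σ (Pos t₀) λ u' → Accessible l t₀ w' u' × GlueZ u u'
            forth' {here} refl r with R-root⁻ l r
            ... | inj₁ (k , refl) = Piece.target (pieceAt L k) , Piece.edge (pieceAt L k) , Piece.related (pieceAt L k)
            ... | inj₂ (refl , loop) =
              x , R-refl l x (loop-reflexive l x (trees L) (λ y r → proj₁ (covers y r)) loop) , refl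
            forth' {down k q} z r with R-embed⁻ l (down k here) r
            ... | q' , refl , r' = forth (Piece.bisim (pieceAt L k)) z r'

            back' : ∀ {w w' u'} → GlueZ w w' → Accessible l t₀ w' u' →
                    Σ (Pos glued) λ u → Accessible l glued w u × GlueZ u u'
            back' {here} refl r = let k , z = covers _ r in down k here , R-root-child l k , z
            back' {down k q} z r = let q' , r' , z' = back (Piece.bisim (pieceAt L k)) z r
                                   in down k q' , R-embed⁺ l (down k here) r' , z'

        glued-refutes-diamonds : Covers → All (λ a → ∀ w → Accessible l glued here w →
                                                 ¬ (model l glued , w ⊩ a) ⊎ (w ≡ here × IsReflexive l)) ds
        glued-refutes-diamonds covers = All.tabulate refute
          where
            refute : ∀ {a} → a ∈ ds → ∀ w → Accessible l glued here w → ¬ (model l glued , w ⊩ a) ⊎ (w ≡ here × IsReflexive l)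
            refute {a} m w acc with R-root⁻ l acc
            ... | inj₁ (k , refl) =
              inj₁ (λ h → All.lookup (Piece.refutes (pieceAt L k)) m (⊩-embed⁻ l (down k here) here a h))
            ... | inj₂ (refl , loop) = inj₂ (refl , loop-reflexive l x (trees L) (λ y acc → proj₁ (covers y acc)) loop)

        glued-refutes-□ : ∀ {a} → Any (λ sp → ¬ (model l (proj₁ sp) , here ⊩ a)) L → ¬ (model l glued , here ⊩ □ a)
        glued-refutes-□ {a} refuter h□ with find refuter
        ... | _ , m , ¬a = ¬a (⊩-embedPiece⁻ (locate L m) here a (h□ _ (R-root-embedPiece (locate L m))))

        FromChildren : ∀ {I Γs} → ChildCountermodels I Γs → Set₁
        FromChildren cms = ∀ {s pc} → (s , pc) ∈ childPieces cms → Located L s pc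

        belowGlue : ∀ {I Γs} (cms : ChildCountermodels I Γs) → FromChildren cms → ℕ → List ℕ → Pos glued
        belowGlue [] f m π = here
        belowGlue (cm ∷ cms) f zero π = here
        belowGlue ((_ , c , _) ∷ cms) f (suc zero) π = embedPiece (f (here refl)) (Countermodel.J c π)
        belowGlue (cm ∷ cms) f (suc (suc m)) π = belowGlue cms (f ∘ there) (suc m) π

        glued-root-edges : ∀ {I Γs} (cms : ChildCountermodels I Γs) (f : FromChildren cms) →
                           Edge (model l glued) (rooted (belowGlue cms f)) [] (seq [] Γs)
        glued-root-edges (cm ∷ cms) f zero = R-root-embedPiece (f (here refl))
        glued-root-edges (cm ∷ cms) f (suc k) = glued-root-edges cms (f ∘ there) k

        glued-children-related : ∀ {I Γs} (cms : ChildCountermodels I Γs) (f : FromChildren cms) →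
                                 InChildren (λ π _ → GlueZ (rooted (belowGlue cms f) π) (I π)) Γs
        glued-children-related [] f ()
        glued-children-related {I} cms₀@((_ , cm) ∷ cms) f =
          inChildren-∷ {P = λ π _ → GlueZ (rooted (belowGlue cms₀ f) π) (I π)}
                       (λ s → GlueZ-embedPiece (f (here refl)) (related-everywhere cm s))
                       (glued-children-related cms (f ∘ there))

        glued-children-edges : ∀ {I Γs} (cms : ChildCountermodels I Γs) (f : FromChildren cms) →
                               InChildren (Edge (model l glued) (rooted (belowGlue cms f))) Γs
        glued-children-edges [] f ()
        glued-children-edges cms₀@((_ , cm) ∷ cms) f =
          inChildren-∷ {P = Edge (model l glued) (rooted (belowGlue cms₀ f))}
                       (λ s k → R-embedPiece (f (here refl)) (edges-everywhere cm s k))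
                       (glued-children-edges cms (f ∘ there))

        glued-children-refuted : ∀ {I Γs} (cms : ChildCountermodels I Γs) (f : FromChildren cms) →
                                 InChildren (λ π Δ → Refutes (model l glued) (rooted (belowGlue cms f) π) (fmls Δ)) Γs
        glued-children-refuted [] f ()
        glued-children-refuted cms₀@((_ , cm) ∷ cms) f =
          inChildren-∷ {P = λ π Δ → Refutes (model l glued) (rooted (belowGlue cms₀ f) π) (fmls Δ)}
                       (λ s → All.map (λ {φ} ¬φ h → ¬φ (⊩-embedPiece⁻ (f (here refl)) _ φ h)) (refuted-everywhere cm s))
                       (glued-children-refuted cms (f ∘ there))

    -- p is made true exactly when p̄ occurs, so every p-literal is refuted unless both occur.
    rootValuation : (ℕ → Bool) → List Literal → ℕ → Bool
    rootValuation w ls q with q ≟ p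
    ... | yes _ = does ((false , p) ∈? ls)
    ... | no _ = w q

    rootValuation-agrees : ∀ w ls q → q ≢ p → rootValuation w ls q ≡ w q
    rootValuation-agrees w ls q q≢p with q ≟ p
    ... | yes q≡p = ⊥-elim (q≢p q≡p)
    ... | no _ = refl

    pAxiom-complete : ∀ {M : Model} {w} ls → (true , p) ∈ ls → (false , p) ∈ ls → M , w ⊩ pAxiom ls
    pAxiom-complete ls m₁ m₀ with (true , p) ∈? ls | (false , p) ∈? ls
    ... | yes _ | yes _ = tt
    ... | no ∉ | _ = ⊥-elim (∉ m₁)
    ... | yes _ | no ∉ = ⊥-elim (∉ m₀)

    literals-refuted : ∀ {M : Model} {x} ls → ¬ M , x ⊩ literalsFormula ls →
                       All (λ li → rootValuation (V M x) ls (proj₂ li) ≢ proj₁ li) ls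
    literals-refuted {M} {x} ls nl = All.tabulate (λ {li} → refute li)
      where
        refute : ∀ li → li ∈ ls → rootValuation (V M x) ls (proj₂ li) ≢ proj₁ li
        refute (b , q) m with q ≟ p
        ... | no q≢p = λ e →
          nl (inj₁ (⊩-⋁⁺ (Any.map⁺ (lose (∈-filter⁺ (λ li → ¬? (proj₂ li ≟ p)) m q≢p)
                                         (⊩-literal⁺ {M = M} {w = x} e)))))
        refute (b , q) m | yes refl = p-literal b m ((false , p) ∈? ls)
          where
            p-literal : ∀ b → (b , p) ∈ ls → (d : Dec ((false , p) ∈ ls)) → does d ≢ b
            p-literal false m (yes _) ()
            p-literal false m (no ∉) _ = ∉ m
            p-literal true m (yes m₀) _ = nl (inj₂ (pAxiom-complete ls m m₀))
            p-literal true m (no _) ()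

    module _ (I : List ℕ → Pos t₀) (r : Residue) where
      open Glue (I []) (diamonds r)

      successorPieces : (ys : List (Pos t₀)) → (∀ {y} → y ∈ ys → Accessible l t₀ (I []) y) →
                        (∀ y → Accessible l t₀ (I []) y → Σ Tree (Refutation y (diamonds r))) → Pieces
      successorPieces [] acc mk = []
      successorPieces (y ∷ ys) acc mk =
        (proj₁ (mk y (acc (here refl))) , record { target = y ; edge = acc (here refl) ; refutation = proj₂ (mk y _) })
        ∷ successorPieces ys (λ m → acc (there m)) mk

      successorPieces-cover : ∀ ys (acc : ∀ {y} → y ∈ ys → Accessible l t₀ (I []) y) mk {y} → y ∈ ys →
                              Any (λ sp → Z (Piece.bisim (proj₂ sp)) here y) (successorPieces ys acc mk)
      successorPieces-cover (y ∷ ys) acc mk (here refl) = here (Refutation.related (proj₂ (mk y _)))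
      successorPieces-cover (y ∷ ys) acc mk (there m) = there (successorPieces-cover ys (λ m → acc (there m)) mk m)

      BoxWitnesses : List Fm → Set₁
      BoxWitnesses = All (λ a → Σ Tree λ s → Piece (I []) (diamonds r) s × ¬ (model l s , here ⊩ a))

      boxPieces : ∀ {bs} → BoxWitnesses bs → Pieces
      boxPieces [] = []
      boxPieces ((s , pc , _) ∷ ws) = (s , pc) ∷ boxPieces ws

      boxPieces-refute : ∀ {bs} (ws : BoxWitnesses bs) →
                         All (λ a → Any (λ sp → ¬ (model l (proj₁ sp) , here ⊩ a)) (boxPieces ws)) bs
      boxPieces-refute [] = []
      boxPieces-refute ((_ , _ , ¬a) ∷ ws) = here ¬a ∷ All.map there (boxPieces-refute ws)

      glue-countermodel : ∀ {Γs} → ¬ (M₀ , I [] ⊩ literalsFormula (literals r)) → ChildCountermodels I Γs →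
                          (∀ y → Accessible l t₀ (I []) y → Σ Tree (Refutation y (diamonds r))) →
                          BoxWitnesses (boxes r) → Σ (Countermodel I Γs) λ c → RefutesResidue l (Countermodel.tree c) here r
      glue-countermodel {Γs} nl cms mk ws =
        c , refutes-literals , glued-refutes-diamonds covers
          , All.map (λ refuter → glued-refutes-□ (Any.++⁺ʳ (childPieces cms) (Any.++⁺ʳ succs refuter)))
                    (boxPieces-refute ws)
        where
          succs : Pieces
          succs = successorPieces (successors l (I [])) (∈-successors⁻ l (I [])) mk
          L : Pieces
          L = childPieces cms ++ succs ++ boxPieces ws
          open Over (rootValuation (val (subtree (I []))) (literals r)) L

          covers : Covers
          covers y acc
            with find (Any.++⁺ʳ (childPieces cms) (Any.++⁺ˡ (successorPieces-cover _ _ mk (∈-successors⁺ l acc))))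
          ... | _ , m , z = located-covers (locate L m) z

          f : FromChildren cms
          f m = locate L (∈-++⁺ˡ m)

          c : Countermodel I Γs
          c = record
            { tree = glued
            ; below = belowGlue cms f
            ; bisim = glue-bisim (rootValuation-agrees _ _) covers
            ; root-related = refl
            ; root-edges = glued-root-edges cms f
            ; children-related = glued-children-related cms f
            ; children-edges = glued-children-edges cms f
            ; children-refuted = glued-children-refuted cms f
            }

          refutes-literals : All (λ li → ¬ (model l glued , here ⊩ literal li)) (literals r)
          refutes-literals = All.map (λ ≢b h → ≢b (⊩-literal⁻ h)) (literals-refuted (literals r) nl)

    open Glue using (ChildCountermodels; []; _∷_)

    mutual
      ui-complete : ∀ n Δ H lab (I : Label → Pos t₀) → Edges M₀ (I ∘ lab) Δ → Everywhere (DepthBelow n) Δ →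
                    All (λ φ → depth φ < n) H → ¬ (M₀ , I ⊨MF ui n Δ H lab) → SequentCountermodel (I ∘ lab) Δ H
      ui-complete n (seq Φ Γs) H lab I E bΔ bH nh
        with saturateAll-complete I n l (H ++ Φ) ∅ ([] , []) (All.++⁺ bH (bΔ here)) nh
      ... | r , bd , nh' , refines =
        let c , ref = uiNode-complete n Γs lab I (E here) (everywhere-children E) (everywhere-children bΔ) r bd nh'
        in c , proj₁ (refines here ref)

      uiNode-complete : ∀ n Γs lab I → Edge M₀ (I ∘ lab) [] (seq [] Γs) → InChildren (Edge M₀ (I ∘ lab)) Γs →
                        InChildren (DepthBelow n) Γs → ∀ r → ResidueDepthBelow n r →
                        ¬ (M₀ , I ⊨MF uiNode n Γs lab r) →
                        Σ (Countermodel (I ∘ lab) Γs) λ c → RefutesResidue l (Countermodel.tree c) here r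
      uiNode-complete zero Γs lab I e₀ es bs r@(residue ls [] []) bd nh =
        glue-countermodel (I ∘ lab) r (nh ∘ inj₁) (uiChildren-complete zero [] Γs lab I e₀ es bs [] (nh ∘ inj₂))
          (λ y _ → subtree y , copy y) []
        where
          copy : ∀ y → Refutation y [] (subtree y)
          copy y = record { bisim = proj₁ (subtree-bisim l p y) ; related = proj₂ (subtree-bisim l p y) ; refutes = [] }
      uiNode-complete zero Γs lab I e₀ es bs (residue ls (d ∷ ds) bxs) ((() ∷ _) , _) nh
      uiNode-complete zero Γs lab I e₀ es bs (residue ls [] (a ∷ bxs)) (_ , (() ∷ _)) nh
      uiNode-complete (suc n) Γs lab I e₀ es bs r (bd , bb) nh =
        glue-countermodel (I ∘ lab) r (nh ∘ inj₁ ∘ inj₁)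
          (uiChildren-complete (suc n) (diamonds r) Γs lab I e₀ es bs (All.map (≤-trans (n≤1+n _)) bd) (nh ∘ inj₂))
          (λ y acc → uiFormula-complete n (diamonds r) y (All.map ≤-pred bd)
                                        (λ h → nh (inj₁ (inj₂ (inj₁ (y , acc , h))))))
          (All.tabulate box-witness)
        where
          x : Pos t₀
          x = I (lab [])

          box-witness : ∀ {a} → a ∈ boxes r → Σ Tree λ s → Piece x (diamonds r) s × ¬ (model l s , here ⊩ a)
          box-witness {a} m
            with ¬□⇒◇¬ l x (λ y → ⊩-dec l y _) (λ h → nh (inj₁ (inj₂ (inj₂ (⊩-⋁⁺ (Any.map⁺ (lose m h)))))))
          ... | w , acc , ¬ui
            with uiFormula-complete n (a ∷ diamonds r) w (≤-pred (All.lookup bb m) ∷ All.map ≤-pred bd) ¬ui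
          ...   | s , ref =
            s , record { target = w ; edge = acc
                       ; refutation = record { bisim = bisim ; related = related ; refutes = All.tail refutes } }
              , All.head refutes
            where open Refutation ref

      uiChildren-complete : ∀ n ds Γs lab I → Edge M₀ (I ∘ lab) [] (seq [] Γs) → InChildren (Edge M₀ (I ∘ lab)) Γs →
                            InChildren (DepthBelow n) Γs → All (λ d → depth d < n) ds →
                            ¬ (M₀ , I ⊨MF uiChildren n ds Γs lab) → ChildCountermodels (I (lab [])) ds (I ∘ lab) Γs
      uiChildren-complete n ds [] lab I e₀ es bs bd nh = []
      uiChildren-complete n ds (c ∷ cs) lab I e₀ es bs bd nh =
        (e₀ zero , ui-complete n c ds _ I (es zero) (bs zero) bd (nh ∘ inj₁))
        ∷ uiChildren-complete n ds cs _ I (λ k → e₀ (suc k)) (λ k → es (suc k)) (λ k → bs (suc k)) bd (nh ∘ inj₂)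

      uiFormula-complete : ∀ n Ψ (v : Pos t₀) → All (λ φ → depth φ < n) Ψ → ¬ (M₀ , v ⊩ uiFormula n Ψ) →
                           Σ Tree (Refutation v Ψ)
      uiFormula-complete n Ψ v bΨ nh
        with ui-complete n (seq Ψ []) [] (λ _ → 1 ∷ []) (λ _ → v) (λ { here () ; (there () _) })
               (λ { here → bΨ ; (there () _) }) [] (nh ∘ ⊨MF-flatten⁺ M₀ v (ui n (seq Ψ []) [] (λ _ → 1 ∷ [])))
      ... | c , ref = tree c , record { bisim = bisim c ; related = root-related c ; refutes = ref }
        where open Countermodel

bnuip : ∀ l → BNUIP (model l)
bnuip l Γ p = A , (uses-only , labelled) , sound , complete
  where
    open Interpolant l p

    n : ℕ
    n = suc (depthSeq Γ)

    A : MF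
    A = ui n Γ [] (1 ∷_)

    uses-only : ∀ q → OccMF q A → OccS q Γ × q ≢ p
    uses-only = ui-vars (λ q → OccS q Γ) n Γ [] _ [] (λ {π} {Δ} s → All.tabulate (λ m q o → π , Δ , s , lose m o))

    labelled : AllLabels (IsLabel Γ) A
    labelled = ui-labels (IsLabel Γ) n Γ [] _ (λ {π} {Δ} s → π , refl , Δ , s)

    sound : ∀ t (𝓘 : Interp Γ (model l t)) → model l t , I 𝓘 ⊨MF A → 𝓘 ⊨S Γ
    sound t 𝓘 h with ui-sound n Γ [] _ (I 𝓘) (Interp⇒Edges 𝓘) h
    ... | inj₂ (π , Δ , s , a) = let φ , m , hφ = find a in 1 ∷ π , φ , (π , refl , Δ , s , m) , hφ

    complete : ∀ t (𝓘 : Interp Γ (model l t)) → ¬ (model l t , I 𝓘 ⊨MF A) →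
               Σ Tree λ t' → Σ (Interp Γ (model l t')) λ 𝓘' → Bisim∼ p Γ 𝓘' 𝓘 × ¬ (𝓘' ⊨S Γ)
    complete t 𝓘 nh = tree c , Edges⇒Interp (J c) (edges-everywhere cm) , (bisim c , related) , refuted
      where
        open Countermodel

        cm : SequentCountermodel (λ π → I 𝓘 (1 ∷ π)) Γ []
        cm = ui-complete n Γ [] _ (I 𝓘) (Interp⇒Edges 𝓘) (depthSeq-bound Γ) [] nh

        c : Countermodel (λ π → I 𝓘 (1 ∷ π)) (nested Γ)
        c = proj₁ cm

        related : ∀ σ → IsLabel Γ σ → Z (bisim c) (J c (drop 1 σ)) (I 𝓘 σ)
        related .(1 ∷ π) (π , refl , Δ , s) = related-everywhere cm s

        refuted : ¬ (Edges⇒Interp (J c) (edges-everywhere cm) ⊨S Γ)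
        refuted (.(1 ∷ π) , φ , (π , refl , Δ , s , m) , h) = All.lookup (refuted-everywhere cm s) m h

theorem5 : BNUIP DModel × BNUIP TModel
theorem5 = bnuip D , bnuip T
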